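{- If $Q$ is a basic sequence that is infinite in limit, then there exists a real number in $[0,1)$ that is $Q$-ratio normal.
   Context: A basic sequence is a sequence $Q=\{q_n\}_{n\ge1}$ of integers with $q_n\ge 2$ for all $n$; it is infinite in limit if $q_n\to\infty$. The $Q$-Cantor series expansion of $x\in[0,1)$ is the unique expansion $x=\sum_{n\ge1}\frac{E_n}{q_1q_2\cdots q_n}$ with $E_n\in\{0,1,\dots,q_n-1\}$ and $E_n\neq q_n-1$ for infinitely many $n$. A block of length $k$ is an ordered $k$-tuple of non-negative integers. For a block $B$ of length $k$, $N_n^Q(B,x)$ is the number of $j\in\{1,\dots,n\}$ with $(E_j,\dots,E_{j+k-1})=B$. $x$ is $Q$-ratio normal of order $k$ if for all blocks $B,B'$ of length $k$, $\lim_{n\to\infty}N_n^Q(B,x)/N_n^Q(B',x)=1$, and $Q$-ratio normal if it is $Q$-ratio normal of order $k$ for every positive integer $k$. -}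

module Defs where

open import Data.Nat using (ℕ; zero; suc; _+_; _*_; _∸_; _≤_; _<_; ∣_-_∣)
import Data.Nat.Properties as ℕP
open import Data.Fin using (Fin; toℕ)
open import Data.Vec using (Vec; tabulate)
open import Data.Vec.Properties using (≡-dec)
open import Data.Product using (Σ; ∃; _×_)
open import Relation.Nullary using (¬_; yes; no)
open import Relation.Binary.PropositionalEquality using (_≡_)

-- Sequences are 0-indexed: q 0 = q_1, E 0 = E_1, etc.

BasicSequence : (ℕ → ℕ) → Set
BasicSequence q = ∀ n → 2 ≤ q n

InfiniteInLimit : (ℕ → ℕ) → Set
InfiniteInLimit q = ∀ M → ∃ λ N → ∀ n → N ≤ n → M ≤ q n

-- E is the digit sequence of a Q-Cantor series expansion of some x ∈ [0,1):
-- 0 ≤ E_n < q_n and E_n ≠ q_n - 1 for infinitely many n.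
-- (Such sequences are in bijection with x ∈ [0,1) via x = Σ E_n/(q_1⋯q_n).)
IsCantorDigits : (ℕ → ℕ) → (ℕ → ℕ) → Set
IsCantorDigits q E =
  (∀ n → E n < q n) × (∀ m → ∃ λ n → m ≤ n × ¬ (E n ≡ q n ∸ 1))

blockAt : (ℕ → ℕ) → (k : ℕ) → ℕ → Vec ℕ k
blockAt E k j = tabulate (λ i → E (j + toℕ i))

count : (E : ℕ → ℕ) → {k : ℕ} → Vec ℕ k → ℕ → ℕ
count E B zero = 0
count E {k} B (suc n) with ≡-dec ℕP._≟_ (blockAt E k n) B
... | yes _ = suc (count E B n)
... | no  _ = count E B n

-- lim_{n→∞} N_n(B)/N_n(B') = 1, written without reals: for every
-- ε = 1/(m+1), eventually N_n(B') > 0 and |N_n(B)/N_n(B') - 1| ≤ ε.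
RatioTendsToOne : (ℕ → ℕ) → (ℕ → ℕ) → Set
RatioTendsToOne a b = ∀ m → ∃ λ M → ∀ n → M ≤ n →
  (0 < b n) × (suc m * ∣ a n - b n ∣ ≤ b n)

RatioNormalOfOrder : (ℕ → ℕ) → ℕ → Set
RatioNormalOfOrder E k = (B B′ : Vec ℕ k) →
  RatioTendsToOne (count E B) (count E B′)

RatioNormal : (ℕ → ℕ) → Set
RatioNormal E = ∀ k → 1 ≤ k → RatioNormalOfOrder E k

-- Stage t of the digit sequence writes the K-digit base-a numerals of 0, 1, …, a^K − 1 one
-- after another, where a = K = t + 2, and repeats this period reps t times. A window of length
-- k ≤ K starting r digits into the numeral m reads digits r, r + 1, … of m + a^K (m + 1), and
-- counting the m for which they spell a given block shows that every block of k digits below a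
-- occurs exactly K a^(K − k) times per period. So once the stages are past the size of a block,
-- its count differs from a count that depends only on its length by at most k per stage
-- boundary, one period of the current stage, and the length of the early stages; reps t grows
-- fast enough to swamp these errors, which gives N_n(B) / N_n(B′) → 1. Letting stage t + 1 start
-- only where q_n ≥ t + 3 keeps all digits legal, and every stage begins with the digit 0 < q_n − 1.

module Submission where

open import Defs
open import Data.Nat
open import Data.Nat.Properties
open import Data.Nat.DivMod
open import Data.Nat.Divisibility using (n∣m*n; m∣m*n)
open import Data.Nat.Tactic.RingSolver using (solve-∀)
open import Data.Fin using (Fin; toℕ)
open import Data.Fin.Properties using (toℕ<n)
open import Data.Vec using (Vec; []; _∷_; tabulate; sum)
open import Data.Vec.Properties using (tabulate-cong; ∷-injective; ≡-dec)
open import Data.Vec.Relation.Unary.All as All using (All; []; _∷_)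
open import Data.Product using (∃; _×_; _,_; proj₁; proj₂)
open import Data.Sum using (inj₁; inj₂)
open import Relation.Binary.Definitions using (tri<; tri≈; tri>)
open import Data.Empty using (⊥-elim)
open import Relation.Nullary using (¬_; yes; no; Dec)
open import Relation.Binary.PropositionalEquality
open import Algebra.Properties.CommutativeSemigroup +-commutativeSemigroup using (interchange)

∑< : ℕ → (ℕ → ℕ) → ℕ
∑< zero    f = 0
∑< (suc n) f = f n + ∑< n f

syntax ∑< n (λ i → e) = ∑[ i < n ] e

∑-cong : ∀ n {f g : ℕ → ℕ} → (∀ i → i < n → f i ≡ g i) → ∑< n f ≡ ∑< n g
∑-cong zero    f≗g = refl
∑-cong (suc n) f≗g = cong₂ _+_ (f≗g n ≤-refl) (∑-cong n (λ i i<n → f≗g i (m≤n⇒m≤1+n i<n)))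

∑-mono-≤ : ∀ n {f g : ℕ → ℕ} → (∀ i → f i ≤ g i) → ∑< n f ≤ ∑< n g
∑-mono-≤ zero    f≤g = z≤n
∑-mono-≤ (suc n) f≤g = +-mono-≤ (f≤g n) (∑-mono-≤ n f≤g)

∑-const : ∀ n c → ∑[ _ < n ] c ≡ n * c
∑-const zero    c = refl
∑-const (suc n) c = cong (c +_) (∑-const n c)

∑-distrib-+ : ∀ n (f g : ℕ → ℕ) → ∑[ i < n ] (f i + g i) ≡ ∑< n f + ∑< n g
∑-distrib-+ zero    f g = refl
∑-distrib-+ (suc n) f g = begin
  f n + g n + ∑[ i < n ] (f i + g i) ≡⟨ cong (f n + g n +_) (∑-distrib-+ n f g) ⟩
  f n + g n + (∑< n f + ∑< n g)      ≡⟨ interchange (f n) (g n) (∑< n f) (∑< n g) ⟩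
  f n + ∑< n f + (g n + ∑< n g)      ∎
  where open ≡-Reasoning

∑-*-distribˡ : ∀ n c (f : ℕ → ℕ) → ∑[ i < n ] (c * f i) ≡ c * ∑< n f
∑-*-distribˡ zero    c f = sym (*-zeroʳ c)
∑-*-distribˡ (suc n) c f = trans (cong (c * f n +_) (∑-*-distribˡ n c f)) (sym (*-distribˡ-+ c (f n) (∑< n f)))

∑-*-distribʳ : ∀ n c (f : ℕ → ℕ) → ∑[ i < n ] (f i * c) ≡ ∑< n f * c
∑-*-distribʳ zero    c f = refl
∑-*-distribʳ (suc n) c f = trans (cong (f n * c +_) (∑-*-distribʳ n c f)) (sym (*-distribʳ-+ c (f n) (∑< n f)))

∑-split : ∀ x y (f : ℕ → ℕ) → ∑< (x + y) f ≡ ∑[ i < y ] f (x + i) + ∑< x f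
∑-split x zero    f = cong (λ n → ∑< n f) (+-identityʳ x)
∑-split x (suc y) f = begin
  ∑< (x + suc y) f                          ≡⟨ cong (λ n → ∑< n f) (+-suc x y) ⟩
  f (x + y) + ∑< (x + y) f                  ≡⟨ cong (f (x + y) +_) (∑-split x y f) ⟩
  f (x + y) + (∑[ i < y ] f (x + i) + ∑< x f) ≡⟨ sym (+-assoc (f (x + y)) _ _) ⟩
  ∑[ i < suc y ] f (x + i) + ∑< x f         ∎
  where open ≡-Reasoning

∑-shift : ∀ n (f : ℕ → ℕ) → ∑< (suc n) f ≡ ∑[ i < n ] f (suc i) + f 0
∑-shift n f = trans (∑-split 1 n f) (cong (∑[ i < n ] f (suc i) +_) (+-identityʳ (f 0)))

∑-nested : ∀ M K (f : ℕ → ℕ) → ∑< (M * K) f ≡ ∑[ m < M ] ∑[ r < K ] f (m * K + r)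
∑-nested zero    K f = refl
∑-nested (suc M) K f = begin
  ∑< (K + M * K) f                                ≡⟨ cong (λ n → ∑< n f) (+-comm K (M * K)) ⟩
  ∑< (M * K + K) f                                ≡⟨ ∑-split (M * K) K f ⟩
  ∑[ r < K ] f (M * K + r) + ∑< (M * K) f         ≡⟨ cong (∑[ r < K ] f (M * K + r) +_) (∑-nested M K f) ⟩
  ∑[ m < suc M ] ∑[ r < K ] f (m * K + r)         ∎
  where open ≡-Reasoning

∑-swap : ∀ M K (f : ℕ → ℕ → ℕ) → ∑[ m < M ] ∑[ r < K ] f m r ≡ ∑[ r < K ] ∑[ m < M ] f m r
∑-swap zero    K f = sym (trans (∑-const K 0) (*-zeroʳ K))
∑-swap (suc M) K f = trans (cong (∑[ r < K ] f M r +_) (∑-swap M K f)) (sym (∑-distrib-+ K (λ r → f M r) _))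

∑-vanishing-tail : ∀ n T (f : ℕ → ℕ) → n ≤ T → (∀ i → n ≤ i → f i ≡ 0) → ∑< T f ≡ ∑< n f
∑-vanishing-tail n T f n≤T tail≡0 = begin
  ∑< T f                          ≡⟨ cong (λ m → ∑< m f) (m+[n∸m]≡n n≤T) ⟨
  ∑< (n + (T ∸ n)) f              ≡⟨ ∑-split n (T ∸ n) f ⟩
  ∑[ i < T ∸ n ] f (n + i) + ∑< n f ≡⟨ cong (_+ ∑< n f) (∑-cong (T ∸ n) (λ i _ → tail≡0 (n + i) (m≤m+n n i))) ⟩
  ∑[ i < T ∸ n ] 0 + ∑< n f       ≡⟨ cong (_+ ∑< n f) (trans (∑-const (T ∸ n) 0) (*-zeroʳ (T ∸ n))) ⟩
  ∑< n f                          ∎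
  where open ≡-Reasoning

𝟙 : ∀ {ℓ} {A : Set ℓ} → Dec A → ℕ
𝟙 (yes _) = 1
𝟙 (no  _) = 0

𝟙-cong : ∀ {ℓ ℓ′} {A : Set ℓ} {A′ : Set ℓ′} → (A → A′) → (A′ → A) →
         (d : Dec A) (d′ : Dec A′) → 𝟙 d ≡ 𝟙 d′
𝟙-cong to from (yes a) (yes _)  = refl
𝟙-cong to from (yes a) (no ¬a′) = ⊥-elim (¬a′ (to a))
𝟙-cong to from (no ¬a) (yes a′) = ⊥-elim (¬a (from a′))
𝟙-cong to from (no _)  (no _)   = refl

𝟙-no : ∀ {ℓ} {A : Set ℓ} → ¬ A → (d : Dec A) → 𝟙 d ≡ 0
𝟙-no ¬a (yes a) = ⊥-elim (¬a a)
𝟙-no ¬a (no _)  = refl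

𝟙-yes : ∀ {ℓ} {A : Set ℓ} → A → (d : Dec A) → 𝟙 d ≡ 1
𝟙-yes a (yes _) = refl
𝟙-yes a (no ¬a) = ⊥-elim (¬a a)

∑-𝟙-≟ : ∀ n v → v < n → ∑[ i < n ] 𝟙 (i ≟ v) ≡ 1
∑-𝟙-≟ (suc n) v v<1+n with n ≟ v
... | yes refl = cong suc (trans (∑-cong n (λ i i<n → 𝟙-no (λ i≡n → <-irrefl i≡n i<n) (i ≟ n)))
                                 (trans (∑-const n 0) (*-zeroʳ n)))
... | no  n≢v  = ∑-𝟙-≟ n v (≤∧≢⇒< (≤-pred v<1+n) (λ v≡n → n≢v (sym v≡n)))

∣-∣≤-intro : ∀ {m n o} → m ≤ n + o → n ≤ m + o → ∣ m - n ∣ ≤ o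
∣-∣≤-intro {m} {n} m≤n+o n≤m+o with ≤-total m n
... | inj₁ m≤n = subst (_≤ _) (sym (m≤n⇒∣m-n∣≡n∸m m≤n)) (m≤n+o⇒m∸n≤o n m n≤m+o)
... | inj₂ n≤m = subst (_≤ _) (sym (m≤n⇒∣n-m∣≡n∸m n≤m)) (m≤n+o⇒m∸n≤o m n m≤n+o)

∣m+n-o+p∣≤∣m-o∣+∣n-p∣ : ∀ m n o p → ∣ m + n - o + p ∣ ≤ ∣ m - o ∣ + ∣ n - p ∣
∣m+n-o+p∣≤∣m-o∣+∣n-p∣ m n o p = begin
  ∣ m + n - o + p ∣                     ≤⟨ ∣-∣-triangle (m + n) (o + n) (o + p) ⟩
  ∣ m + n - o + n ∣ + ∣ o + n - o + p ∣ ≡⟨ cong₂ _+_ (trans (cong₂ ∣_-_∣ (+-comm m n) (+-comm o n)) (∣m+n-m+o∣≡∣n-o∣ n m o))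
                                                      (∣m+n-m+o∣≡∣n-o∣ o n p) ⟩
  ∣ m - o ∣ + ∣ n - p ∣                 ∎
  where open ≤-Reasoning

∑-∣-∣ : ∀ n (f g : ℕ → ℕ) → ∣ ∑< n f - ∑< n g ∣ ≤ ∑[ i < n ] ∣ f i - g i ∣
∑-∣-∣ zero    f g = z≤n
∑-∣-∣ (suc n) f g = ≤-trans (∣m+n-o+p∣≤∣m-o∣+∣n-p∣ (f n) (∑< n f) (g n) (∑< n g))
                            (+-monoʳ-≤ ∣ f n - g n ∣ (∑-∣-∣ n f g))

ratio-from-approximation : ∀ m {x y J w} → ∣ x - J ∣ ≤ w → ∣ y - J ∣ ≤ w → 0 < w → suc m * (w + w) + w ≤ J →
                           0 < y × suc m * ∣ x - y ∣ ≤ y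
ratio-from-approximation m {x} {y} {J} {w} x≈J y≈J 0<w margin =
  ≤-trans 0<w (≤-trans (m≤m+n w w) (≤-trans (m≤n*m (w + w) (suc m)) 2w-below-y)) ,
  ≤-trans (*-monoʳ-≤ (suc m) x≈y) 2w-below-y
  where
  x≈y : ∣ x - y ∣ ≤ w + w
  x≈y = ≤-trans (∣-∣-triangle x J y) (+-mono-≤ x≈J (subst (_≤ w) (∣-∣-comm y J) y≈J))
  J≤y+w : J ≤ y + w
  J≤y+w = ≤-trans (m≤n+∣m-n∣ J y) (+-monoʳ-≤ y (subst (_≤ w) (∣-∣-comm y J) y≈J))
  2w-below-y : suc m * (w + w) ≤ y
  2w-below-y = +-cancelʳ-≤ w (suc m * (w + w)) y (≤-trans margin J≤y+w)

margin≤N³X : ∀ {N X m k T s c} → 3 ≤ N → N * N ≤ X → suc m ≤ N → k ≤ N → T ≤ N → s ≤ N → c ≤ X →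
                let w = k * T + (c + s) in suc m * (w + w) + w ≤ N * (N * (N * X))
margin≤N³X {N} {X} {m} {k} {T} {s} {c} 3≤N N*N≤X m<N k≤N T≤N s≤N c≤X = begin
  suc m * (w + w) + w       ≤⟨ +-mono-≤ (*-monoˡ-≤ (w + w) m<N) (m≤n*m w N) ⟩
  N * (w + w) + N * w       ≡⟨ rearrange N w ⟩
  N * (3 * w)               ≤⟨ *-monoʳ-≤ N (*-monoʳ-≤ 3 w≤3X) ⟩
  N * (3 * (3 * X))         ≡⟨ cong (N *_) (*-assoc 3 3 X) ⟨
  N * (9 * X)               ≤⟨ *-monoʳ-≤ N (*-monoˡ-≤ X (*-mono-≤ 3≤N 3≤N)) ⟩
  N * (N * N * X)           ≡⟨ cong (N *_) (*-assoc N N X) ⟩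
  N * (N * (N * X))         ∎
  where
  open ≤-Reasoning
  w = k * T + (c + s)
  instance
    N≢0 : NonZero N
    N≢0 = >-nonZero (≤-trans (s≤s z≤n) 3≤N)
  N≤X : N ≤ X
  N≤X = ≤-trans (m≤m*n N N) N*N≤X
  w≤3X : w ≤ 3 * X
  w≤3X = begin
    k * T + (c + s)   ≤⟨ +-mono-≤ (*-mono-≤ k≤N T≤N) (+-mono-≤ c≤X s≤N) ⟩
    N * N + (X + N)   ≤⟨ +-mono-≤ N*N≤X (+-monoʳ-≤ X N≤X) ⟩
    X + (X + X)       ≡⟨ cong (λ y → X + (X + y)) (+-identityʳ X) ⟨
    3 * X             ∎
  rearrange : ∀ N w → N * (w + w) + N * w ≡ N * (3 * w)
  rearrange = solve-∀

divMod-unique : ∀ n .{{_ : NonZero n}} {x} r q → r < n → x ≡ r + q * n → x % n ≡ r × x / n ≡ q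
divMod-unique n {x} r q r<n refl = x%n≡r , *-cancelʳ-≡ (x / n) q n (+-cancelˡ-≡ r _ _ (sym x≡r+[x/n]*n))
  where
  x%n≡r : x % n ≡ r
  x%n≡r = trans ([m+kn]%n≡m%n r q n) (m<n⇒m%n≡m r<n)
  x≡r+[x/n]*n : x ≡ r + x / n * n
  x≡r+[x/n]*n = trans (m≡m%n+[m/n]*n x n) (cong (_+ x / n * n) x%n≡r)

[m+kn]/n≡m/n+k : ∀ m k n .{{_ : NonZero n}} → (m + k * n) / n ≡ m / n + k
[m+kn]/n≡m/n+k m k n = trans (+-distrib-/-∣ʳ m (n∣m*n k)) (cong (m / n +_) (m*n/n≡m k n))

m%[n*o]≡m%n+n*[m/n%o] : ∀ m n o .{{_ : NonZero n}} .{{_ : NonZero o}} .{{_ : NonZero (n * o)}} →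
                        m % (n * o) ≡ m % n + n * (m / n % o)
m%[n*o]≡m%n+n*[m/n%o] m n o = begin
  m % (n * o)                             ≡⟨ m≡m%n+[m/n]*n (m % (n * o)) n ⟩
  m % (n * o) % n + m % (n * o) / n * n   ≡⟨ cong₂ (λ x y → x + y * n) (m∣n⇒o%n%m≡o%m n (n * o) m (m∣m*n o)) high-digits ⟩
  m % n + m / n % o * n                   ≡⟨ cong (m % n +_) (*-comm (m / n % o) n) ⟩
  m % n + n * (m / n % o)                 ∎
  where
  open ≡-Reasoning
  instance
    o*n≢0 : NonZero (o * n)
    o*n≢0 = m*n≢0 o n
  high-digits : m % (n * o) / n ≡ m / n % o
  high-digits = trans (/-congˡ (%-congʳ (*-comm n o))) (m%[n*o]/o≡m/o%n m o n)

mixedRadix-< : ∀ a A r s → r < a → s < A → r + a * s < a * A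
mixedRadix-< a A r s r<a s<A = begin-strict
  r + a * s <⟨ +-monoˡ-< (a * s) r<a ⟩
  a + a * s ≡⟨ *-suc a s ⟨
  a * suc s ≤⟨ *-monoʳ-≤ a s<A ⟩
  a * A     ∎
  where open ≤-Reasoning

mixedRadix-injective : ∀ a .{{_ : NonZero a}} r s r′ s′ → r < a → r′ < a →
                       r + a * s ≡ r′ + a * s′ → r ≡ r′ × s ≡ s′
mixedRadix-injective a r s r′ s′ r<a r′<a eq =
  trans (sym (proj₁ rs)) (proj₁ rs′) , trans (sym (proj₂ rs)) (proj₂ rs′)
  where
  rs  = divMod-unique a r s r<a (cong (r +_) (*-comm a s))
  rs′ = divMod-unique a r′ s′ r′<a (trans eq (cong (r′ +_) (*-comm a s′)))

𝟙-mixedRadix : ∀ a .{{_ : NonZero a}} r s r′ s′ → r < a → r′ < a →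
               𝟙 (r + a * s ≟ r′ + a * s′) ≡ 𝟙 (r ≟ r′) * 𝟙 (s ≟ s′)
𝟙-mixedRadix a r s r′ s′ r<a r′<a with r ≟ r′ | s ≟ s′
... | yes refl | yes refl = 𝟙-yes refl (r + a * s ≟ r + a * s)
... | yes _ | no s≢s′ = 𝟙-no (λ eq → s≢s′ (proj₂ (mixedRadix-injective a r s r′ s′ r<a r′<a eq))) _
... | no r≢r′ | _ = 𝟙-no (λ eq → r≢r′ (proj₁ (mixedRadix-injective a r s r′ s′ r<a r′<a eq))) _

∑-𝟙-%-window : ∀ d .{{_ : NonZero d}} v → v < d → ∀ w → ∑[ i < d ] 𝟙 ((w + i) % d ≟ v) ≡ 1
∑-𝟙-%-window d v v<d zero = trans (∑-cong d (λ i i<d → cong (λ x → 𝟙 (x ≟ v)) (m<n⇒m%n≡m i<d)))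
                                      (∑-𝟙-≟ d v v<d)
∑-𝟙-%-window d v v<d (suc w) = +-cancelʳ-≡ (f w) _ _ (begin
  ∑[ i < d ] f (suc w + i) + f w       ≡⟨ cong₂ _+_ (∑-cong d (λ i _ → cong f (sym (+-suc w i)))) (cong f (sym (+-identityʳ w))) ⟩
  ∑[ i < d ] f (w + suc i) + f (w + 0) ≡⟨ sym (∑-shift d (λ i → f (w + i))) ⟩
  ∑[ i < suc d ] f (w + i)             ≡⟨ cong₂ _+_ (cong (λ x → 𝟙 (x ≟ v)) ([m+n]%n≡m%n w d)) (∑-𝟙-%-window d v v<d w) ⟩
  f w + 1                              ≡⟨ +-comm (f w) 1 ⟩
  1 + f w                              ∎)
  where
  open ≡-Reasoning
  f : ℕ → ℕ
  f x = 𝟙 (x % d ≟ v)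

∑-𝟙-%-periods : ∀ c d .{{_ : NonZero d}} v → v < d → ∀ w → ∑[ x < c * d ] 𝟙 ((w + x) % d ≟ v) ≡ c
∑-𝟙-%-periods c d v v<d w = begin
  ∑[ x < c * d ] 𝟙 ((w + x) % d ≟ v)                 ≡⟨ ∑-nested c d _ ⟩
  ∑[ m < c ] ∑[ r < d ] 𝟙 ((w + (m * d + r)) % d ≟ v) ≡⟨ ∑-cong c (λ m _ → one-period m) ⟩
  ∑[ m < c ] 1                                       ≡⟨ trans (∑-const c 1) (*-identityʳ c) ⟩
  c                                                  ∎
  where
  open ≡-Reasoning
  drop-multiple : ∀ m r → (w + (m * d + r)) % d ≡ (w + r) % d
  drop-multiple m r = trans (cong (_% d) (rearrange w m d r)) ([m+kn]%n≡m%n (w + r) m d)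
    where
    rearrange : ∀ w m d r → w + (m * d + r) ≡ w + r + m * d
    rearrange = solve-∀
  one-period : ∀ m → ∑[ r < d ] 𝟙 ((w + (m * d + r)) % d ≟ v) ≡ 1
  one-period m = trans (∑-cong d (λ r _ → cong (λ x → 𝟙 (x ≟ v)) (drop-multiple m r))) (∑-𝟙-%-window d v v<d w)

module Digits (b : ℕ) where

  a : ℕ
  a = suc b

  -- a ^ d, written as a successor so that instance search finds NonZero (a^ d)
  a^-pred : ℕ → ℕ
  a^-pred zero    = 0
  a^-pred (suc d) = a^-pred d + b * suc (a^-pred d)

  a^_ : ℕ → ℕ
  a^ d = suc (a^-pred d)

  a^≡^ : ∀ d → a^ d ≡ a ^ d
  a^≡^ zero    = refl
  a^≡^ (suc d) = cong (a *_) (a^≡^ d)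

  a^-+ : ∀ d e → a^ (d + e) ≡ a^ d * a^ e
  a^-+ d e = begin
    a^ (d + e)      ≡⟨ a^≡^ (d + e) ⟩
    a ^ (d + e)     ≡⟨ ^-distribˡ-+-* a d e ⟩
    a ^ d * a ^ e   ≡⟨ cong₂ _*_ (a^≡^ d) (a^≡^ e) ⟨
    a^ d * a^ e     ∎
    where open ≡-Reasoning

  a^-mono-≤ : ∀ {d e} → d ≤ e → a^ d ≤ a^ e
  a^-mono-≤ {d} {e} d≤e = subst₂ _≤_ (sym (a^≡^ d)) (sym (a^≡^ e)) (^-monoʳ-≤ a d≤e)

  digit : ℕ → ℕ → ℕ
  digit d x = x / a^ d % a

  digits : (k : ℕ) → ℕ → Vec ℕ k
  digits k x = tabulate (λ i → digit (toℕ i) x)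

  fromDigits : ∀ {k} → Vec ℕ k → ℕ
  fromDigits []      = 0
  fromDigits (c ∷ B) = c + a * fromDigits B

  digit<a : ∀ d x → digit d x < a
  digit<a d x = m%n<n (x / a^ d) a

  digits-suc : ∀ k x → digits (suc k) x ≡ x % a ∷ digits k (x / a)
  digits-suc k x = cong₂ _∷_ (cong (_% a) (n/1≡n x))
    (tabulate-cong (λ i → cong (_% a) (sym (m/n/o≡m/[n*o] x a (a^ toℕ i)))))

  fromDigits-< : ∀ {k} (B : Vec ℕ k) → All (_< a) B → fromDigits B < a^ k
  fromDigits-< []      []       = s≤s z≤n
  fromDigits-< (c ∷ B) (c<a ∷ B<a) = mixedRadix-< a _ c (fromDigits B) c<a (fromDigits-< B B<a)

  digits≡⇒%≡ : ∀ {k} (B : Vec ℕ k) x → digits k x ≡ B → x % a^ k ≡ fromDigits B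
  digits≡⇒%≡ []      x eq = n%1≡0 x
  digits≡⇒%≡ {suc k} (c ∷ B) x eq = begin
    x % (a * a^ k)                ≡⟨ m%[n*o]≡m%n+n*[m/n%o] x a (a^ k) ⟩
    x % a + a * (x / a % a^ k)    ≡⟨ cong₂ (λ u v → u + a * v) (proj₁ heads) (digits≡⇒%≡ B (x / a) (proj₂ heads)) ⟩
    c + a * fromDigits B          ∎
    where
    open ≡-Reasoning
    heads = ∷-injective (trans (sym (digits-suc k x)) eq)

  %≡⇒digits≡ : ∀ {k} (B : Vec ℕ k) → All (_< a) B → ∀ x → x % a^ k ≡ fromDigits B → digits k x ≡ B
  %≡⇒digits≡ []      []        x eq = refl
  %≡⇒digits≡ {suc k} (c ∷ B) (c<a ∷ B<a) x eq =
    trans (digits-suc k x) (cong₂ _∷_ (proj₁ parts) (%≡⇒digits≡ B B<a (x / a) (proj₂ parts)))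
    where
    parts = mixedRadix-injective a (x % a) (x / a % a^ k) c (fromDigits B) (m%n<n x a) c<a
              (trans (sym (m%[n*o]≡m%n+n*[m/n%o] x a (a^ k))) eq)

  tabulate-digit-+ : ∀ k r x → tabulate (λ (i : Fin k) → digit (r + toℕ i) x) ≡ digits k (x / a^ r)
  tabulate-digit-+ k r x = tabulate-cong (λ i → cong (_% a) (begin
    x / a^ (r + toℕ i)          ≡⟨ /-congʳ {m = x} (a^-+ r (toℕ i)) ⟩
    x / (a^ r * a^ toℕ i)       ≡⟨ m/n/o≡m/[n*o] x (a^ r) (a^ toℕ i) ⟨
    x / a^ r / a^ toℕ i         ∎))
    where open ≡-Reasoning

  digit-+-high : ∀ {d D} x z → d < D → digit d (x + a^ D * z) ≡ digit d x
  digit-+-high {d} {D} x z d<D = begin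
    (x + a^ D * z) / a^ d % a                  ≡⟨ cong (λ y → (x + y) / a^ d % a) a^D*z≡ ⟩
    (x + a^ e * z * a * a^ d) / a^ d % a        ≡⟨ cong (_% a) ([m+kn]/n≡m/n+k x (a^ e * z * a) (a^ d)) ⟩
    (x / a^ d + a^ e * z * a) % a               ≡⟨ [m+kn]%n≡m%n (x / a^ d) (a^ e * z) a ⟩
    x / a^ d % a                                ∎
    where
    open ≡-Reasoning
    e = D ∸ suc d
    a^D*z≡ : a^ D * z ≡ a^ e * z * a * a^ d
    a^D*z≡ = begin
      a^ D * z                   ≡⟨ cong (λ n → a^ n * z) (m+[n∸m]≡n d<D) ⟨
      a^ (suc d + e) * z         ≡⟨ cong (_* z) (a^-+ (suc d) e) ⟩
      a * a^ d * a^ e * z        ≡⟨ rearrange a (a^ d) (a^ e) z ⟩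
      a^ e * z * a * a^ d        ∎
      where
      rearrange : ∀ a p q z → a * p * q * z ≡ q * z * a * p
      rearrange = solve-∀

  digit-shift : ∀ K e x z → x < a^ K → digit (K + e) (x + a^ K * z) ≡ digit e z
  digit-shift K e x z x<a^K = cong (_% a) (begin
    (x + a^ K * z) / a^ (K + e)         ≡⟨ /-congʳ {m = x + a^ K * z} (a^-+ K e) ⟩
    (x + a^ K * z) / (a^ K * a^ e)      ≡⟨ m/n/o≡m/[n*o] (x + a^ K * z) (a^ K) (a^ e) ⟨
    (x + a^ K * z) / a^ K / a^ e        ≡⟨ cong (λ y → (x + y) / a^ K / a^ e) (*-comm (a^ K) z) ⟩
    (x + z * a^ K) / a^ K / a^ e        ≡⟨ cong (_/ a^ e) ([m+kn]/n≡m/n+k x z (a^ K)) ⟩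
    (x / a^ K + z) / a^ e               ≡⟨ cong (λ y → (y + z) / a^ e) (m<n⇒m/n≡0 x<a^K) ⟩
    z / a^ e                            ∎)
    where open ≡-Reasoning

  %-a^-mixedRadix : ∀ u s h w → h < a^ u → (h + a^ u * w) % a^ (u + s) ≡ h + a^ u * (w % a^ s)
  %-a^-mixedRadix u s h w h<a^u = begin
    x % a^ (u + s)                        ≡⟨ %-congʳ {o = x} (a^-+ u s) ⟩
    x % (a^ u * a^ s)                     ≡⟨ m%[n*o]≡m%n+n*[m/n%o] x (a^ u) (a^ s) ⟩
    x % a^ u + a^ u * (x / a^ u % a^ s)   ≡⟨ cong₂ (λ p q → p + a^ u * (q % a^ s)) (proj₁ h,w) (proj₂ h,w) ⟩
    h + a^ u * (w % a^ s)                 ∎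
    where
    open ≡-Reasoning
    x = h + a^ u * w
    h,w = divMod-unique (a^ u) {x} h w h<a^u (cong (h +_) (*-comm (a^ u) w))

occurs : (E : ℕ → ℕ) {k : ℕ} → Vec ℕ k → ℕ → ℕ
occurs E {k} B j = 𝟙 (≡-dec _≟_ (blockAt E k j) B)

count≡∑occurs : ∀ E {k} (B : Vec ℕ k) n → count E B n ≡ ∑[ j < n ] occurs E B j
count≡∑occurs E {k} B zero = refl
count≡∑occurs E {k} B (suc n) with ≡-dec _≟_ (blockAt E k n) B
... | yes _ = cong suc (count≡∑occurs E B n)
... | no  _ = count≡∑occurs E B n

count≤ : ∀ E {k} (B : Vec ℕ k) n → count E B n ≤ n
count≤ E {k} B zero = z≤n
count≤ E {k} B (suc n) with ≡-dec _≟_ (blockAt E k n) B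
... | yes _ = s≤s (count≤ E B n)
... | no  _ = m≤n⇒m≤1+n (count≤ E B n)

count-cong : ∀ E F {k} (B : Vec ℕ k) n → (∀ j → j < n → blockAt E k j ≡ blockAt F k j) →
             count E B n ≡ count F B n
count-cong E F B n same = begin
  count E B n               ≡⟨ count≡∑occurs E B n ⟩
  ∑[ j < n ] occurs E B j   ≡⟨ ∑-cong n (λ j j<n → cong (λ C → 𝟙 (≡-dec _≟_ C B)) (same j j<n)) ⟩
  ∑[ j < n ] occurs F B j   ≡⟨ count≡∑occurs F B n ⟨
  count F B n               ∎
  where open ≡-Reasoning

count-+ : ∀ E {k} (B : Vec ℕ k) x y → count E B (x + y) ≡ count (λ j → E (x + j)) B y + count E B x
count-+ E {k} B x y = begin
  count E B (x + y)                                     ≡⟨ count≡∑occurs E B (x + y) ⟩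
  ∑< (x + y) (occurs E B)                               ≡⟨ ∑-split x y (occurs E B) ⟩
  ∑[ j < y ] occurs E B (x + j) + ∑< x (occurs E B)     ≡⟨ cong₂ _+_ (∑-cong y (λ j _ → cong (λ C → 𝟙 (≡-dec _≟_ C B)) (shifted-block j)))
                                                                     (sym (count≡∑occurs E B x)) ⟩
  ∑[ j < y ] occurs (λ j → E (x + j)) B j + count E B x ≡⟨ cong (_+ count E B x) (count≡∑occurs (λ j → E (x + j)) B y) ⟨
  count (λ j → E (x + j)) B y + count E B x             ∎
  where
  open ≡-Reasoning
  shifted-block : ∀ j → blockAt E k (x + j) ≡ blockAt (λ j → E (x + j)) k j
  shifted-block j = tabulate-cong (λ i → cong E (+-assoc x j (toℕ i)))

count-mono : ∀ E {k} (B : Vec ℕ k) {x y} → x ≤ y → count E B x ≤ count E B y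
count-mono E B {x} x≤y = subst (λ n → count E B x ≤ count E B n) (m+[n∸m]≡n x≤y)
  (subst (count E B x ≤_) (sym (count-+ E B x _)) (m≤n+m (count E B x) _))

count-+-≤ : ∀ E {k} (B : Vec ℕ k) x y → count E B (x + y) ≤ count E B x + y
count-+-≤ E B x y = begin
  count E B (x + y)                           ≡⟨ count-+ E B x y ⟩
  count (λ j → E (x + j)) B y + count E B x   ≤⟨ +-monoˡ-≤ (count E B x) (count≤ (λ j → E (x + j)) B y) ⟩
  y + count E B x                             ≡⟨ +-comm y (count E B x) ⟩
  count E B x + y                             ∎
  where open ≤-Reasoning

count-periodic : ∀ E P → (∀ j → E (j + P) ≡ E j) → ∀ {k} (B : Vec ℕ k) p → count E B (p * P) ≡ p * count E B P
count-periodic E P periodic B zero    = refl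
count-periodic E P periodic B (suc p) = begin
  count E B (P + p * P)                                      ≡⟨ cong (count E B) (+-comm P (p * P)) ⟩
  count E B (p * P + P)                                      ≡⟨ count-+ E B (p * P) P ⟩
  count (λ j → E (p * P + j)) B P + count E B (p * P)        ≡⟨ cong₂ _+_ (count-cong _ E B P (λ j _ → tabulate-cong (λ i → shift-invariant p (j + toℕ i))))
                                                                          (count-periodic E P periodic B p) ⟩
  count E B P + p * count E B P                              ∎
  where
  open ≡-Reasoning
  shift-invariant : ∀ p j → E (p * P + j) ≡ E j
  shift-invariant zero    j = refl
  shift-invariant (suc p) j = begin
    E (P + p * P + j)   ≡⟨ cong E (rearrange P p j) ⟩
    E (p * P + (j + P)) ≡⟨ shift-invariant p (j + P) ⟩
    E (j + P)           ≡⟨ periodic j ⟩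
    E j                 ∎
    where
    rearrange : ∀ P p j → P + p * P + j ≡ p * P + (j + P)
    rearrange = solve-∀

count-agree-≤ : ∀ E F {k} (B : Vec ℕ k) x → (∀ i → i < x → E i ≡ F i) → count E B x ≤ count F B x + k
count-agree-≤ E F {k} B x agree = begin
  count E B x             ≤⟨ count-mono E B (subst (x ≤_) (+-comm k (x ∸ k)) (m≤n+m∸n x k)) ⟩
  count E B (x ∸ k + k)   ≤⟨ count-+-≤ E B (x ∸ k) k ⟩
  count E B (x ∸ k) + k   ≡⟨ cong (_+ k) (count-cong E F B (x ∸ k) same-blocks) ⟩
  count F B (x ∸ k) + k   ≤⟨ +-monoˡ-≤ k (count-mono F B (m∸n≤m x k)) ⟩
  count F B x + k         ∎
  where
  open ≤-Reasoning
  same-blocks : ∀ j → j < x ∸ k → blockAt E k j ≡ blockAt F k j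
  same-blocks j j<x∸k = tabulate-cong (λ i → agree (j + toℕ i) (begin-strict
    j + toℕ i   <⟨ +-monoʳ-< j (toℕ<n i) ⟩
    j + k       <⟨ +-monoˡ-< k j<x∸k ⟩
    x ∸ k + k   ≡⟨ m∸n+n≡m {x} {k} (<⇒≤ (m∸n≢0⇒n<m (m<n⇒n≢0 j<x∸k))) ⟩
    x           ∎))

module CounterWord (b c : ℕ) where
  open Digits b public

  K : ℕ
  K = suc c

  -- The K-digit base-a numerals of 0, 1, 2, … written one after another, least significant digit first.
  word : ℕ → ℕ
  word j = digit (j % K) (j / K)

  period : ℕ
  period = a^ K * K

  period-pos : 0 < period
  period-pos = z<s

  word<a : ∀ j → word j < a
  word<a j = digit<a (j % K) (j / K)

  word-numeral : ∀ m r → r < K → word (m * K + r) ≡ digit r m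
  word-numeral m r r<K = cong₂ digit (proj₁ r,m) (proj₂ r,m)
    where r,m = divMod-unique K r m r<K (+-comm (m * K) r)

  word-periodic : ∀ j → word (j + period) ≡ word j
  word-periodic j = begin
    digit ((j + a^ K * K) % K) ((j + a^ K * K) / K)   ≡⟨ cong₂ digit ([m+kn]%n≡m%n j (a^ K) K) ([m+kn]/n≡m/n+k j (a^ K) K) ⟩
    digit (j % K) (j / K + a^ K)                      ≡⟨ cong (λ n → digit (j % K) (j / K + n)) (*-identityʳ (a^ K)) ⟨
    digit (j % K) (j / K + a^ K * 1)                  ≡⟨ digit-+-high (j / K) 1 (m%n<n j K) ⟩
    digit (j % K) (j / K)                             ∎
    where open ≡-Reasoning

  -- the numerals of m and m + 1 side by side
  pair : ℕ → ℕ
  pair m = m + a^ K * suc m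

  word-pair : ∀ m p → p < K + K → m < a^ K → word (m * K + p) ≡ digit p (pair m)
  word-pair m p p<2K m<a^K with p <? K
  ... | yes p<K = trans (word-numeral m p p<K) (sym (digit-+-high m (suc m) p<K))
  ... | no  p≮K = begin
    word (m * K + p)         ≡⟨ cong word (trans (cong (m * K +_) (sym (m+[n∸m]≡n K≤p))) (rearrange m K e)) ⟩
    word (suc m * K + e)     ≡⟨ word-numeral (suc m) e (+-cancelˡ-< K e K (subst (_< K + K) (sym (m+[n∸m]≡n K≤p)) p<2K)) ⟩
    digit e (suc m)          ≡⟨ digit-shift K e m (suc m) m<a^K ⟨
    digit (K + e) (pair m)   ≡⟨ cong (λ n → digit n (pair m)) (m+[n∸m]≡n K≤p) ⟩
    digit p (pair m)         ∎
    where
    open ≡-Reasoning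
    K≤p = ≮⇒≥ p≮K
    e = p ∸ K
    rearrange : ∀ m K e → m * K + (K + e) ≡ suc m * K + e
    rearrange = solve-∀

  blockAt-word : ∀ k r m → k ≤ K → r < K → m < a^ K → blockAt word k (m * K + r) ≡ digits k (pair m / a^ r)
  blockAt-word k r m k≤K r<K m<a^K = trans (tabulate-cong at) (tabulate-digit-+ k r (pair m))
    where
    at : ∀ (i : Fin k) → word (m * K + r + toℕ i) ≡ digit (r + toℕ i) (pair m)
    at i = trans (cong word (+-assoc (m * K) r (toℕ i)))
                 (word-pair m (r + toℕ i) (+-mono-< r<K (<-≤-trans (toℕ<n i) k≤K)) m<a^K)

  pair-/ : ∀ r u h l → K ≡ r + u → l < a^ r → pair (h * a^ r + l) / a^ r ≡ h + a^ u * suc (h * a^ r + l)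
  pair-/ r u h l K≡r+u l<a^r = proj₂ (divMod-unique (a^ r) l (h + a^ u * m′) l<a^r (begin
    h * a^ r + l + a^ K * m′          ≡⟨ cong (λ n → h * a^ r + l + a^ n * m′) K≡r+u ⟩
    h * a^ r + l + a^ (r + u) * m′    ≡⟨ cong (λ n → h * a^ r + l + n * m′) (a^-+ r u) ⟩
    h * a^ r + l + a^ r * a^ u * m′   ≡⟨ rearrange h (a^ r) l (a^ u) m′ ⟩
    l + (h + a^ u * m′) * a^ r        ∎))
    where
    open ≡-Reasoning
    m′ = suc (h * a^ r + l)
    rearrange : ∀ h p l q m → h * p + l + p * q * m ≡ l + (h + q * m) * p
    rearrange = solve-∀

  ∑-pair-low : ∀ r k f v → v < a^ k →
    ∑[ h < a^ (k + f) ] ∑[ l < a^ r ] 𝟙 ((h + a^ (k + f) * suc (h * a^ r + l)) % a^ k ≟ v) ≡ a^ (r + f)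
  ∑-pair-low r k f v v<a^k = begin
    ∑[ h < a^ (k + f) ] ∑[ l < a^ r ] 𝟙 ((h + a^ (k + f) * suc (h * a^ r + l)) % a^ k ≟ v)
      ≡⟨ ∑-cong (a^ (k + f)) (λ h _ → trans (∑-cong (a^ r) (λ l _ → cong (λ x → 𝟙 (x ≟ v)) (high-vanishes h _)))
                                            (∑-const (a^ r) _)) ⟩
    ∑[ h < a^ (k + f) ] (a^ r * 𝟙 (h % a^ k ≟ v))
      ≡⟨ ∑-*-distribˡ (a^ (k + f)) (a^ r) _ ⟩
    a^ r * ∑[ h < a^ (k + f) ] 𝟙 (h % a^ k ≟ v)
      ≡⟨ cong (λ n → a^ r * ∑[ h < n ] 𝟙 (h % a^ k ≟ v)) (trans (a^-+ k f) (*-comm (a^ k) (a^ f))) ⟩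
    a^ r * ∑[ h < a^ f * a^ k ] 𝟙 (h % a^ k ≟ v)
      ≡⟨ cong (a^ r *_) (∑-𝟙-%-periods (a^ f) (a^ k) v v<a^k 0) ⟩
    a^ r * a^ f
      ≡⟨ a^-+ r f ⟨
    a^ (r + f) ∎
    where
    open ≡-Reasoning
    high-vanishes : ∀ h w → (h + a^ (k + f) * w) % a^ k ≡ h % a^ k
    high-vanishes h w = begin
      (h + a^ (k + f) * w) % a^ k       ≡⟨ cong (λ n → (h + n * w) % a^ k) (a^-+ k f) ⟩
      (h + a^ k * a^ f * w) % a^ k      ≡⟨ cong (λ n → (h + n) % a^ k) (rearrange (a^ k) (a^ f) w) ⟩
      (h + a^ f * w * a^ k) % a^ k      ≡⟨ [m+kn]%n≡m%n h (a^ f * w) (a^ k) ⟩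
      h % a^ k                          ∎
      where
      rearrange : ∀ p q w → p * q * w ≡ q * w * p
      rearrange = solve-∀

  ∑-pair-straddle : ∀ u s g v → v < a^ (u + s) →
    ∑[ h < a^ u ] ∑[ l < a^ (s + g) ] 𝟙 ((h + a^ u * suc (h * a^ (s + g) + l)) % a^ (u + s) ≟ v) ≡ a^ g
  ∑-pair-straddle u s g v v<a^[u+s] = begin
    ∑[ h < a^ u ] ∑[ l < a^ (s + g) ] 𝟙 ((h + a^ u * suc (h * a^ (s + g) + l)) % a^ (u + s) ≟ v)
      ≡⟨ ∑-cong (a^ u) (λ h h<a^u → ∑-cong (a^ (s + g)) (λ l _ → factorise h l h<a^u)) ⟩
    ∑[ h < a^ u ] ∑[ l < a^ (s + g) ] (𝟙 (h ≟ v₀) * 𝟙 ((1 + l) % a^ s ≟ v₁))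
      ≡⟨ ∑-cong (a^ u) (λ h _ → ∑-*-distribˡ (a^ (s + g)) (𝟙 (h ≟ v₀)) _) ⟩
    ∑[ h < a^ u ] (𝟙 (h ≟ v₀) * ∑[ l < a^ (s + g) ] 𝟙 ((1 + l) % a^ s ≟ v₁))
      ≡⟨ ∑-*-distribʳ (a^ u) _ (λ h → 𝟙 (h ≟ v₀)) ⟩
    ∑[ h < a^ u ] 𝟙 (h ≟ v₀) * ∑[ l < a^ (s + g) ] 𝟙 ((1 + l) % a^ s ≟ v₁)
      ≡⟨ cong₂ _*_ (∑-𝟙-≟ (a^ u) v₀ (m%n<n v (a^ u))) low-count ⟩
    1 * a^ g
      ≡⟨ *-identityˡ (a^ g) ⟩
    a^ g ∎
    where
    open ≡-Reasoning
    v₀ = v % a^ u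
    v₁ = v / a^ u
    v≡v₀+a^u*v₁ : v ≡ v₀ + a^ u * v₁
    v≡v₀+a^u*v₁ = trans (m≡m%n+[m/n]*n v (a^ u)) (cong (v₀ +_) (*-comm v₁ (a^ u)))
    v₁<a^s : v₁ < a^ s
    v₁<a^s = m<n*o⇒m/o<n (subst (v <_) (trans (a^-+ u s) (*-comm (a^ u) (a^ s))) v<a^[u+s])
    low-count : ∑[ l < a^ (s + g) ] 𝟙 ((1 + l) % a^ s ≟ v₁) ≡ a^ g
    low-count = trans (cong (λ n → ∑[ l < n ] 𝟙 ((1 + l) % a^ s ≟ v₁)) (trans (a^-+ s g) (*-comm (a^ s) (a^ g))))
                      (∑-𝟙-%-periods (a^ g) (a^ s) v₁ v₁<a^s 1)
    factorise : ∀ h l → h < a^ u →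
      𝟙 ((h + a^ u * suc (h * a^ (s + g) + l)) % a^ (u + s) ≟ v) ≡ 𝟙 (h ≟ v₀) * 𝟙 ((1 + l) % a^ s ≟ v₁)
    factorise h l h<a^u = begin
      𝟙 ((h + a^ u * w) % a^ (u + s) ≟ v)                ≡⟨ cong (λ x → 𝟙 (x ≟ v)) (%-a^-mixedRadix u s h w h<a^u) ⟩
      𝟙 (h + a^ u * (w % a^ s) ≟ v)                      ≡⟨ cong₂ (λ x y → 𝟙 (h + a^ u * x ≟ y)) w%a^s v≡v₀+a^u*v₁ ⟩
      𝟙 (h + a^ u * ((1 + l) % a^ s) ≟ v₀ + a^ u * v₁)   ≡⟨ 𝟙-mixedRadix (a^ u) h _ v₀ v₁ h<a^u (m%n<n v (a^ u)) ⟩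
      𝟙 (h ≟ v₀) * 𝟙 ((1 + l) % a^ s ≟ v₁)               ∎
      where
      w = suc (h * a^ (s + g) + l)
      w%a^s : w % a^ s ≡ (1 + l) % a^ s
      w%a^s = begin
        suc (h * a^ (s + g) + l) % a^ s       ≡⟨ cong (λ n → suc (h * n + l) % a^ s) (a^-+ s g) ⟩
        suc (h * (a^ s * a^ g) + l) % a^ s    ≡⟨ cong (_% a^ s) (rearrange h (a^ s) (a^ g) l) ⟩
        (1 + l + h * a^ g * a^ s) % a^ s      ≡⟨ [m+kn]%n≡m%n (1 + l) (h * a^ g) (a^ s) ⟩
        (1 + l) % a^ s                        ∎
        where
        rearrange : ∀ h p q l → suc (h * (p * q) + l) ≡ 1 + l + h * q * p
        rearrange = solve-∀

  -- With m = h a^r + l, the window shows h, the top u digits of m, followed by low digits of m + 1,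
  -- which depend on l only: for k ≤ u the window stays inside m, for u < k it crosses into m + 1.
  ∑-pair-digits : ∀ r u k v → K ≡ r + u → k ≤ K → v < a^ k →
    ∑[ m < a^ K ] 𝟙 (pair m / a^ r % a^ k ≟ v) ≡ a^ (K ∸ k)
  ∑-pair-digits r u k v K≡r+u k≤K v<a^k = begin
    ∑[ m < a^ K ] 𝟙 (pair m / a^ r % a^ k ≟ v)
      ≡⟨ cong (λ n → ∑[ m < n ] 𝟙 (pair m / a^ r % a^ k ≟ v)) a^K≡a^u*a^r ⟩
    ∑[ m < a^ u * a^ r ] 𝟙 (pair m / a^ r % a^ k ≟ v)
      ≡⟨ ∑-nested (a^ u) (a^ r) _ ⟩
    ∑[ h < a^ u ] ∑[ l < a^ r ] 𝟙 (pair (h * a^ r + l) / a^ r % a^ k ≟ v)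
      ≡⟨ ∑-cong (a^ u) (λ h _ → ∑-cong (a^ r) (λ l l<a^r → cong (λ x → 𝟙 (x % a^ k ≟ v)) (pair-/ r u h l K≡r+u l<a^r))) ⟩
    ∑[ h < a^ u ] ∑[ l < a^ r ] 𝟙 ((h + a^ u * suc (h * a^ r + l)) % a^ k ≟ v)
      ≡⟨ by-cases (k ≤? u) ⟩
    a^ (K ∸ k) ∎
    where
    open ≡-Reasoning
    a^K≡a^u*a^r : a^ K ≡ a^ u * a^ r
    a^K≡a^u*a^r = trans (cong a^_ K≡r+u) (trans (a^-+ r u) (*-comm (a^ r) (a^ u)))
    by-cases : Dec (k ≤ u) →
      ∑[ h < a^ u ] ∑[ l < a^ r ] 𝟙 ((h + a^ u * suc (h * a^ r + l)) % a^ k ≟ v) ≡ a^ (K ∸ k)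
    by-cases (yes k≤u) with m≤n⇒∃[o]m+o≡n k≤u
    ... | f , refl = trans (∑-pair-low r k f v v<a^k) (cong a^_ (sym K∸k≡r+f))
      where
      K∸k≡r+f : K ∸ k ≡ r + f
      K∸k≡r+f = trans (cong (_∸ k) K≡r+u) (trans (cong (_∸ k) (rearrange r k f)) (m+n∸n≡m (r + f) k))
        where
        rearrange : ∀ r k f → r + (k + f) ≡ r + f + k
        rearrange = solve-∀
    by-cases (no k≰u) with m≤n⇒∃[o]m+o≡n (<⇒≤ (≰⇒> k≰u))
    ... | s , refl with m≤n⇒∃[o]m+o≡n (+-cancelʳ-≤ u s r (subst₂ _≤_ (+-comm u s) K≡r+u k≤K))
    ...   | g , refl = trans (∑-pair-straddle u s g v v<a^k) (cong a^_ (sym K∸k≡g))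
      where
      K∸k≡g : K ∸ k ≡ g
      K∸k≡g = trans (cong (_∸ (u + s)) K≡r+u) (trans (cong (_∸ (u + s)) (rearrange s g u)) (m+n∸m≡n (u + s) g))
        where
        rearrange : ∀ s g u → s + g + u ≡ u + s + g
        rearrange = solve-∀

  count-period : ∀ {k} (B : Vec ℕ k) → All (_< a) B → k ≤ K → count word B period ≡ K * a^ (K ∸ k)
  count-period {k} B B<a k≤K = begin
    count word B period                                        ≡⟨ count≡∑occurs word B period ⟩
    ∑< (a^ K * K) (occurs word B)                              ≡⟨ ∑-nested (a^ K) K _ ⟩
    ∑[ m < a^ K ] ∑[ r < K ] occurs word B (m * K + r)         ≡⟨ ∑-swap (a^ K) K _ ⟩
    ∑[ r < K ] ∑[ m < a^ K ] occurs word B (m * K + r)         ≡⟨ ∑-cong K per-offset ⟩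
    ∑[ r < K ] a^ (K ∸ k)                                      ≡⟨ ∑-const K _ ⟩
    K * a^ (K ∸ k)                                             ∎
    where
    open ≡-Reasoning
    per-offset : ∀ r → r < K → ∑[ m < a^ K ] occurs word B (m * K + r) ≡ a^ (K ∸ k)
    per-offset r r<K = trans (∑-cong (a^ K) (λ m m<a^K →
        let block≡ = blockAt-word k r m k≤K r<K m<a^K in
        𝟙-cong (λ eq → digits≡⇒%≡ B (pair m / a^ r) (trans (sym block≡) eq))
               (λ eq → trans block≡ (%≡⇒digits≡ B B<a (pair m / a^ r) eq)) _ _))
      (∑-pair-digits r (K ∸ r) k (fromDigits B) (sym (m+[n∸m]≡n (<⇒≤ r<K))) k≤K (fromDigits-< B B<a))

  count-word : ∀ {k} (B : Vec ℕ k) → All (_< a) B → k ≤ K → ∀ p → count word B (p * period) ≡ p * (K * a^ (K ∸ k))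
  count-word B B<a k≤K p = trans (count-periodic word period word-periodic B p) (cong (p *_) (count-period B B<a k≤K))

module Concatenation (W : ℕ → ℕ → ℕ) (L : ℕ → ℕ) (L-pos : ∀ t → 0 < L t) where

  stageStart : ℕ → ℕ
  stageStart T = ∑< T L

  stageStart-mono : ∀ {T T′} → T ≤ T′ → stageStart T ≤ stageStart T′
  stageStart-mono {T} T≤T′ = subst (λ n → stageStart T ≤ stageStart n) (m+[n∸m]≡n T≤T′)
    (subst (stageStart T ≤_) (sym (∑-split T _ L)) (m≤n+m (stageStart T) _))

  T≤stageStart : ∀ T → T ≤ stageStart T
  T≤stageStart zero    = z≤n
  T≤stageStart (suc T) = +-mono-≤ (L-pos T) (T≤stageStart T)

  InStage : ℕ → ℕ → Set
  InStage T n = stageStart T ≤ n × n < stageStart (suc T)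

  stage : ℕ → ℕ
  stage zero = 0
  stage (suc n) with suc n <? stageStart (suc (stage n))
  ... | yes _ = stage n
  ... | no  _ = suc (stage n)

  stage-spec : ∀ n → InStage (stage n) n
  stage-spec zero    = z≤n , +-monoˡ-≤ 0 (L-pos 0)
  stage-spec (suc n) with suc n <? stageStart (suc (stage n)) | stage-spec n
  ... | yes n<end | start≤n , _     = m≤n⇒m≤1+n start≤n , n<end
  ... | no  n≮end | _       , n<end = end≤n , subst (_< L (suc (stage n)) + stageStart (suc (stage n))) n≡end
                                                   (+-monoˡ-< (stageStart (suc (stage n))) (L-pos (suc (stage n))))
    where
    end≤n = ≮⇒≥ n≮end
    n≡end : stageStart (suc (stage n)) ≡ suc n
    n≡end = ≤-antisym end≤n n<end

  stage-unique : ∀ {T T′ n} → InStage T n → InStage T′ n → T ≡ T′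
  stage-unique {T} {T′} (start≤n , n<end) (start′≤n , n<end′) with <-cmp T T′
  ... | tri< T<T′ _ _ = ⊥-elim (<-irrefl refl (<-≤-trans n<end (≤-trans (stageStart-mono T<T′) start′≤n)))
  ... | tri≈ _ T≡T′ _ = T≡T′
  ... | tri> _ _ T′<T = ⊥-elim (<-irrefl refl (<-≤-trans n<end′ (≤-trans (stageStart-mono T′<T) start≤n)))

  stage-≥ : ∀ {T n} → stageStart T ≤ n → T ≤ stage n
  stage-≥ {T} {n} start≤n with T ≤? stage n
  ... | yes T≤stage = T≤stage
  ... | no  T≰stage = ⊥-elim (<-irrefl refl (<-≤-trans (proj₂ (stage-spec n))
                                                       (≤-trans (stageStart-mono (≰⇒> T≰stage)) start≤n)))

  from-stage-onwards : ∀ (P : ℕ → Set) T → (∀ T′ x → T ≤ T′ → x < L T′ → P (stageStart T′ + x)) →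
                       ∀ n → stageStart T ≤ n → P n
  from-stage-onwards P T P-stagewise n start≤n =
    subst P (m+[n∸m]≡n (proj₁ n∈stage)) (P-stagewise (stage n) (n ∸ stageStart (stage n)) (stage-≥ start≤n) x<L)
    where
    n∈stage = stage-spec n
    x<L : n ∸ stageStart (stage n) < L (stage n)
    x<L = +-cancelˡ-< (stageStart (stage n)) _ _
            (subst₂ _<_ (sym (m+[n∸m]≡n (proj₁ n∈stage))) (+-comm (L (stage n)) _) (proj₂ n∈stage))

  concat : ℕ → ℕ
  concat n = W (stage n) (n ∸ stageStart (stage n))

  concat-stage : ∀ T {n} → InStage T n → concat n ≡ W T (n ∸ stageStart T)
  concat-stage T {n} n∈T = cong (λ t → W t (n ∸ stageStart t)) (stage-unique (stage-spec n) n∈T)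

  concat-at : ∀ T x → x < L T → concat (stageStart T + x) ≡ W T x
  concat-at T x x<L = trans (concat-stage T (m≤m+n (stageStart T) x , in-stage)) (cong (W T) (m+n∸m≡n (stageStart T) x))
    where
    in-stage : stageStart T + x < L T + stageStart T
    in-stage = subst (stageStart T + x <_) (+-comm (stageStart T) (L T)) (+-monoʳ-< (stageStart T) x<L)

  count-within-stage : ∀ {k} (B : Vec ℕ k) T x → x ≤ L T →
                       ∣ count (λ j → concat (stageStart T + j)) B x - count (W T) B x ∣ ≤ k
  count-within-stage B T x x≤L = ∣-∣≤-intro
    (count-agree-≤ _ (W T) B x (λ i i<x → concat-at T i (<-≤-trans i<x x≤L)))
    (count-agree-≤ (W T) _ B x (λ i i<x → sym (concat-at T i (<-≤-trans i<x x≤L))))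

  count-concat-start : ∀ {k} (B : Vec ℕ k) T →
                       ∣ count concat B (stageStart T) - ∑[ t < T ] count (W t) B (L t) ∣ ≤ k * T
  count-concat : ∀ {k} (B : Vec ℕ k) T x → x ≤ L T →
                 ∣ count concat B (stageStart T + x) - (count (W T) B x + ∑[ t < T ] count (W t) B (L t)) ∣ ≤ k * suc T

  count-concat-start B zero    = z≤n
  count-concat-start {k} B (suc T) =
    subst (λ n → ∣ count concat B n - ∑[ t < suc T ] count (W t) B (L t) ∣ ≤ k * suc T)
          (+-comm (stageStart T) (L T)) (count-concat B T (L T) ≤-refl)

  count-concat {k} B T x x≤L = begin
    ∣ count concat B (stageStart T + x) - here + earlier ∣   ≡⟨ cong (λ n → ∣ n - here + earlier ∣) (count-+ concat B (stageStart T) x) ⟩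
    ∣ here′ + earlier′ - here + earlier ∣                    ≤⟨ ∣m+n-o+p∣≤∣m-o∣+∣n-p∣ here′ earlier′ here earlier ⟩
    ∣ here′ - here ∣ + ∣ earlier′ - earlier ∣                ≤⟨ +-mono-≤ (count-within-stage B T x x≤L) (count-concat-start B T) ⟩
    k + k * T                                                ≡⟨ *-suc k T ⟨
    k * suc T                                                ∎
    where
    open ≤-Reasoning
    here′ = count (λ j → concat (stageStart T + j)) B x
    earlier′ = count concat B (stageStart T)
    here = count (W T) B x
    earlier = ∑[ t < T ] count (W t) B (L t)

All-≤-sum : ∀ {k} (B : Vec ℕ k) → All (_≤ sum B) B
All-≤-sum []      = []
All-≤-sum (x ∷ B) = m≤m+n x (sum B) ∷ All.map (λ y≤ΣB → ≤-trans y≤ΣB (m≤n+m (sum B) x)) (All-≤-sum B)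

module Construction (q : ℕ → ℕ) (q→∞ : InfiniteInLimit q) where

  module Stage (t : ℕ) = CounterWord (suc t) (suc t)
  open Stage using (word; period; K)

  -- The first summand makes q ≥ t + 3 on stage t + 1, the second swamps the errors (margin≤N³X).
  reps : ℕ → ℕ
  reps t = proj₁ (q→∞ (3 + t)) + (3 + t) ^ (7 + t)

  len : ℕ → ℕ
  len t = reps t * period t

  len-pos : ∀ t → 0 < len t
  len-pos t = *-mono-< (<-≤-trans (m^n>0 (3 + t) (7 + t)) (m≤n+m ((3 + t) ^ (7 + t)) (proj₁ (q→∞ (3 + t))))) (Stage.period-pos t)

  open Concatenation word len len-pos public

  perPeriod : ℕ → ℕ → ℕ
  perPeriod k t = K t * Stage.a^_ t (K t ∸ k)

  Active : ∀ {k} → Vec ℕ k → ℕ → Set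
  Active {k} B t = All (_< 2 + t) B × k ≤ 2 + t

  count-stage : ∀ {k t} (B : Vec ℕ k) → Active B t → count (word t) B (len t) ≡ reps t * perPeriod k t
  count-stage {t = t} B (B<a , k≤K) = Stage.count-word t B B<a k≤K (reps t)

  count-stage-prefix : ∀ {k t} (B : Vec ℕ k) → Active B t → ∀ x →
                       ∣ count (word t) B x - x / period t * perPeriod k t ∣ ≤ perPeriod k t
  count-stage-prefix {k} {t} B (B<a , k≤K) x = ∣-∣≤-intro upper lower
    where
    P = period t
    c = perPeriod k t
    p = x / P
    x≤[1+p]*P : x ≤ suc p * P
    x≤[1+p]*P = begin
      x             ≡⟨ m≡m%n+[m/n]*n x P ⟩
      x % P + p * P ≤⟨ +-monoˡ-≤ (p * P) (<⇒≤ (m%n<n x P)) ⟩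
      P + p * P     ∎
      where open ≤-Reasoning
    lower : p * c ≤ count (word t) B x + c
    lower = ≤-trans (subst (_≤ count (word t) B x) (Stage.count-word t B B<a k≤K p) (count-mono (word t) B (m/n*n≤m x P)))
                    (m≤m+n _ c)
    upper : count (word t) B x ≤ p * c + c
    upper = subst (count (word t) B x ≤_) (trans (Stage.count-word t B B<a k≤K (suc p)) (+-comm c (p * c)))
                  (count-mono (word t) B x≤[1+p]*P)

  perPeriod≤period : ∀ k t → perPeriod k t ≤ period t
  perPeriod≤period k t = subst (perPeriod k t ≤_) (*-comm (K t) (Stage.a^_ t (K t)))
                               (*-monoʳ-≤ (K t) (Stage.a^-mono-≤ t (m∸n≤m (K t) k)))

  ideal : ℕ → ℕ → ℕ → ℕ
  ideal k T x = x / period T * perPeriod k T + ∑[ t < T ] (reps t * perPeriod k t)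

  stagewise-near-ideal : ∀ {k} (B : Vec ℕ k) t0 → (∀ t → t0 ≤ t → Active B t) → ∀ T x → t0 ≤ T →
    ∣ count (word T) B x + ∑[ t < T ] count (word t) B (len t) - ideal k T x ∣ ≤ perPeriod k T + stageStart t0
  stagewise-near-ideal {k} B t0 active T x t0≤T =
    ≤-trans (∣m+n-o+p∣≤∣m-o∣+∣n-p∣ (count (word T) B x) (∑< T actual) (x / period T * perPeriod k T) (∑< T expected))
            (+-mono-≤ (count-stage-prefix B (active T t0≤T) x) earlier)
    where
    actual expected error : ℕ → ℕ
    actual t = count (word t) B (len t)
    expected t = reps t * perPeriod k t
    error t = ∣ actual t - expected t ∣
    error≤len : ∀ t → error t ≤ len t
    error≤len t = ≤-trans (∣m-n∣≤m⊔n (actual t) (expected t))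
                          (⊔-lub (count≤ (word t) B (len t)) (*-monoʳ-≤ (reps t) (perPeriod≤period k t)))
    no-error : ∀ t → t0 ≤ t → error t ≡ 0
    no-error t t0≤t = trans (cong (λ n → ∣ n - expected t ∣) (count-stage B (active t t0≤t))) (∣n-n∣≡0 (expected t))
    earlier : ∣ ∑< T actual - ∑< T expected ∣ ≤ stageStart t0
    earlier = begin
      ∣ ∑< T actual - ∑< T expected ∣ ≤⟨ ∑-∣-∣ T actual expected ⟩
      ∑< T error                      ≡⟨ ∑-vanishing-tail t0 T error t0≤T no-error ⟩
      ∑< t0 error                     ≤⟨ ∑-mono-≤ t0 error≤len ⟩
      stageStart t0                   ∎
      where open ≤-Reasoning

  count-near-ideal : ∀ {k} (B : Vec ℕ k) t0 → (∀ t → t0 ≤ t → Active B t) → ∀ T x → t0 ≤ T → x < len T →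
    ∣ count concat B (stageStart T + x) - ideal k T x ∣ ≤ k * suc T + (perPeriod k T + stageStart t0)
  count-near-ideal {k} B t0 active T x t0≤T x<len =
    ≤-trans (∣-∣-triangle (count concat B (stageStart T + x)) stagewise (ideal k T x))
            (+-mono-≤ (count-concat B T x (<⇒≤ x<len)) (stagewise-near-ideal B t0 active T x t0≤T))
    where stagewise = count (word T) B x + ∑[ t < T ] count (word t) B (len t)

  Active-beyond : ∀ {k} (B : Vec ℕ k) t → k + sum B ≤ t → Active B t
  Active-beyond {k} B t k+ΣB≤t =
    All.map (λ x≤ΣB → s≤s (≤-trans x≤ΣB (≤-trans (m≤n+m (sum B) k) (≤-trans k+ΣB≤t (n≤1+n t))))) (All-≤-sum B) ,
    ≤-trans (m≤m+n k (sum B)) (≤-trans k+ΣB≤t (m≤n+m t 2))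

  ratio-estimate : ∀ {k} (B B′ : Vec ℕ k) m t0 → (∀ t → t0 ≤ t → Active B t) → (∀ t → t0 ≤ t → Active B′ t) →
    k ≤ t0 → ∀ T x → suc (t0 + (stageStart t0 + m)) ≤ T → x < len T →
    0 < count concat B′ (stageStart T + x) ×
    suc m * ∣ count concat B (stageStart T + x) - count concat B′ (stageStart T + x) ∣ ≤ count concat B′ (stageStart T + x)
  ratio-estimate {k} B B′ m t0 active active′ k≤t0 (suc U) x (s≤s t0+start+m≤U) x<len =
    ratio-from-approximation m {count concat B n} {count concat B′ n} {ideal k T x} {w} (count-near-ideal B t0 active T x t0≤T x<len)
                               (count-near-ideal B′ t0 active′ T x t0≤T x<len) 0<w margin
    where
    T = suc U
    n = stageStart T + x
    N = 3 + U
    X = N ^ (4 + U)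
    w = k * suc T + (perPeriod k T + stageStart t0)
    t0≤U : t0 ≤ U
    t0≤U = ≤-trans (m≤m+n t0 _) t0+start+m≤U
    start≤U : stageStart t0 ≤ U
    start≤U = ≤-trans (m≤m+n (stageStart t0) m) (≤-trans (m≤n+m _ t0) t0+start+m≤U)
    m≤U : m ≤ U
    m≤U = ≤-trans (m≤n+m m (stageStart t0)) (≤-trans (m≤n+m _ t0) t0+start+m≤U)
    t0≤T : t0 ≤ T
    t0≤T = ≤-trans t0≤U (n≤1+n U)
    3≤N : 3 ≤ N
    3≤N = m≤m+n 3 U
    m<N : m < N
    m<N = s≤s (≤-trans m≤U (m≤n+m U 2))
    ≤N : ∀ {y} → y ≤ U → y ≤ N
    ≤N y≤U = ≤-trans y≤U (m≤n+m U 3)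
    0<w : 0 < w
    0<w = ≤-trans z<s (m≤n+m (perPeriod k T + stageStart t0) (k * suc T))
    perPeriod≤X : perPeriod k T ≤ X
    perPeriod≤X = ≤-trans (*-monoʳ-≤ N (Stage.a^-mono-≤ T (m∸n≤m N k))) (≤-reflexive (cong (N *_) (Stage.a^≡^ T N)))
    N*N≤X : N * N ≤ X
    N*N≤X = subst (_≤ X) (cong (N *_) (*-identityʳ N)) (^-monoʳ-≤ N {2} {4 + U} (s≤s (s≤s z≤n)))
    margin : suc m * (w + w) + w ≤ ideal k T x
    margin = begin
      suc m * (w + w) + w                             ≤⟨ margin≤N³X 3≤N N*N≤X m<N (≤N (≤-trans k≤t0 t0≤U)) (n≤1+n (suc T))
                                                                       (≤N start≤U) perPeriod≤X ⟩
      N * (N * (N * X))                               ≤⟨ m≤n+m _ (proj₁ (q→∞ (3 + U))) ⟩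
      reps U                                          ≤⟨ m≤m*n (reps U) (perPeriod k U) ⟩
      reps U * perPeriod k U                          ≤⟨ m≤m+n _ _ ⟩
      ∑[ t < T ] (reps t * perPeriod k t)             ≤⟨ m≤n+m _ (x / period T * perPeriod k T) ⟩
      ideal k T x                                     ∎
      where open ≤-Reasoning

  ratioNormalOfOrder : ∀ k → RatioNormalOfOrder concat k
  ratioNormalOfOrder k B B′ m =
    stageStart (suc U₀) , from-stage-onwards _ (suc U₀) (ratio-estimate B B′ m t0 active active′ k≤t0)
    where
    t0 = (k + sum B) + (k + sum B′)
    U₀ = t0 + (stageStart t0 + m)
    active : ∀ t → t0 ≤ t → Active B t
    active t t0≤t = Active-beyond B t (≤-trans (m≤m+n _ _) t0≤t)
    active′ : ∀ t → t0 ≤ t → Active B′ t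
    active′ t t0≤t = Active-beyond B′ t (≤-trans (m≤n+m (k + sum B′) (k + sum B)) t0≤t)
    k≤t0 : k ≤ t0
    k≤t0 = ≤-trans (m≤m+n k (sum B)) (m≤m+n _ _)

  concat<q : BasicSequence q → ∀ n → concat n < q n
  concat<q q≥2 n = <-≤-trans (Stage.word<a (stage n) (n ∸ stageStart (stage n))) (base≤q (stage n) (stage-spec n))
    where
    base≤q : ∀ T → InStage T n → 2 + T ≤ q n
    base≤q zero    _             = q≥2 n
    base≤q (suc U) (start≤n , _) = proj₂ (q→∞ (3 + U)) n (begin
      proj₁ (q→∞ (3 + U))     ≤⟨ m≤m+n _ _ ⟩
      reps U                  ≤⟨ m≤m*n (reps U) (period U) ⟩
      len U                   ≤⟨ m≤m+n (len U) (stageStart U) ⟩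
      stageStart (suc U)      ≤⟨ start≤n ⟩
      n                       ∎)
      where open ≤-Reasoning

  concat-stageStart : ∀ t → concat (stageStart t) ≡ 0
  concat-stageStart t = trans (cong concat (sym (+-identityʳ (stageStart t)))) (concat-at t 0 (len-pos t))

  nonmaximal-infinitely-often : BasicSequence q → ∀ m → ∃ λ n → m ≤ n × ¬ (concat n ≡ q n ∸ 1)
  nonmaximal-infinitely-often q≥2 m = stageStart m , T≤stageStart m ,
    λ 0≡q-1 → <⇒≢ (∸-monoˡ-≤ 1 (q≥2 (stageStart m))) (trans (sym (concat-stageStart m)) 0≡q-1)

mainTheorem6 : (q : ℕ → ℕ) → BasicSequence q → InfiniteInLimit q →
    ∃ λ (E : ℕ → ℕ) → IsCantorDigits q E × RatioNormal E
mainTheorem6 q q≥2 q→∞ = concat , (concat<q q≥2 , nonmaximal-infinitely-often q≥2) , λ k _ → ratioNormalOfOrder k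
  where open Construction q q→∞
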